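{- Fix $k\in\mathbb Z_{\ge0}$. Let $\psi\colon M(2,\mathbb Z)\to M(2,\mathbb Z)$ be \[\psi\begin{bmatrix} m_{11}&m_{12}\\ m_{21}&m_{22}\end{bmatrix}=\begin{bmatrix} -m_{11}+m_{12}k-k & m_{12}\\ m_{21}-(k+3)m_{11}+k(2k+3)(m_{12}-1) & -m_{22}+(2k+3)m_{12}-k\end{bmatrix}.\] Then $\psi$ is a bijection of $M(2,\mathbb Z)$, and it restricts to a bijection from the set of $k$-MM matrices onto the set of $k$-GC matrices.
   Context: $M(2,\mathbb Z)$ is the set of $2\times2$ integer matrices. Fix $k\in\mathbb Z_{\ge0}$. A $k$-GM triple is a triple $(a,b,c)\in\mathbb Z_{\ge1}^3$ with $a^2+b^2+c^2+k(bc+ca+ab)=(3+3k)abc$; a $k$-GM number is a positive integer occurring as an entry of some $k$-GM triple. A $k$-GC matrix is $P=(p_{ij})\in SL(2,\mathbb Z)$ such that $p_{12}$ is a $k$-GM number and $\operatorname{tr}(P)=(3k+3)p_{12}-k$. A $k$-MM matrix is $X=(x_{ij})\in SL(2,\mathbb Z)$ such that $x_{12}$ is a $k$-GM number and $\operatorname{tr}(X)=-k$. -}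

module Defs where

open import Data.Nat using (ℕ; suc)
open import Data.Integer using (ℤ; +_; _+_; _-_; _*_; -_)
open import Data.Product using (Σ; ∃; _×_; _,_)
open import Data.Sum using (_⊎_)
open import Relation.Binary.PropositionalEquality using (_≡_)

record Mat : Set where
  constructor mat
  field
    m11 m12 m21 m22 : ℤ
open Mat public

det : Mat → ℤ
det (mat a b c d) = a * d - b * c

tr : Mat → ℤ
tr (mat a b c d) = a + d

InSL2 : Mat → Set
InSL2 M = det M ≡ + 1

IsGMTriple : ℕ → ℕ → ℕ → ℕ → Set
IsGMTriple k a b c =
  let K = + k ; A = + suc a ; B = + suc b ; C = + suc c in
  A * A + B * B + C * C + K * (B * C + C * A + A * B)
    ≡ (+ 3 + + 3 * K) * A * B * C
-- note: entries are suc a, suc b, suc c (positive integers)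

IsGMNumber : ℕ → ℤ → Set
IsGMNumber k x = ∃ λ a → ∃ λ b → ∃ λ c → IsGMTriple k a b c ×
  (x ≡ + suc a ⊎ (x ≡ + suc b ⊎ x ≡ + suc c))

IsGC : ℕ → Mat → Set
IsGC k P = InSL2 P × IsGMNumber k (m12 P) × (tr P ≡ (+ 3 * + k + + 3) * m12 P - + k)

IsMM : ℕ → Mat → Set
IsMM k X = InSL2 X × IsGMNumber k (m12 X) × (tr X ≡ - (+ k))

ψ : ℕ → Mat → Mat
ψ k (mat a b c d) =
  let K = + k in
  mat (- a + b * K - K)
      b
      (c - (K + + 3) * a + K * (+ 2 * K + + 3) * (b - + 1))
      (- d + (+ 2 * K + + 3) * b - K)

-- ψ is the composite of a shear, which adds an affine function of (m11, m12) to m21, and a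
-- reflection of each diagonal entry, so it is invertible and fixes m12. It maps trace -k to
-- trace (3k+3) m12 - k and conversely, because tr X + tr (ψ X) depends on m12 X alone, and
-- det (ψ X) = det X - k (m12 X - 1)(tr X + k), so the determinant is preserved when
-- tr X = -k.
{-# OPTIONS --safe #-}
module Submission where

open import Defs
open import Data.Nat using (ℕ)
open import Data.Integer using (ℤ; +_; +0; _+_; _-_; _*_; -_)
open import Data.Integer.Properties using (+-0-abelianGroup; +-inverseˡ; +-identityʳ; *-zeroʳ)
open import Algebra.Properties.AbelianGroup +-0-abelianGroup using (∙-cancelˡ; ∙-cancelʳ)
open import Data.Integer.Tactic.RingSolver using (solve-∀)
open import Data.Product using (Σ; _×_; _,_)
open import Function.Bundles using (_⇔_; mk⇔; Equivalence)
open import Function.Consequences.Propositional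
  using (inverseᵇ⇒bijective; strictlyInverseˡ⇒inverseˡ; strictlyInverseʳ⇒inverseʳ)
open import Function.Definitions using (Bijective)
open import Relation.Binary.PropositionalEquality
  using (_≡_; refl; sym; trans; cong; cong₂; subst; module ≡-Reasoning)

open ≡-Reasoning

equal-sums⇒≡ˡ⇔≡ʳ : ∀ {t u c e : ℤ} → t + u ≡ c + e → (t ≡ c ⇔ u ≡ e)
equal-sums⇒≡ˡ⇔≡ʳ {t} {u} {c} {e} t+u≡c+e = mk⇔
  (λ { refl → ∙-cancelˡ t u e t+u≡c+e })
  (λ { refl → ∙-cancelʳ u t c t+u≡c+e })

i≡-j⇒i+j≡0 : ∀ {i j : ℤ} → i ≡ - j → i + j ≡ +0
i≡-j⇒i+j≡0 {j = j} refl = +-inverseˡ j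

module _ (k : ℕ) where

  private
    K : ℤ
    K = + k

  shear : Mat → Mat
  shear (mat a b c d) = mat a b (c - (K + + 3) * a + K * (+ 2 * K + + 3) * (b - + 1)) d

  shear⁻¹ : Mat → Mat
  shear⁻¹ (mat a b c d) = mat a b (c + (K + + 3) * a - K * (+ 2 * K + + 3) * (b - + 1)) d

  reflect : Mat → Mat
  reflect (mat a b c d) = mat (- a + b * K - K) b c (- d + (+ 2 * K + + 3) * b - K)

  ψ≡reflect∘shear : ∀ X → ψ k X ≡ reflect (shear X)
  ψ≡reflect∘shear X = refl

  shear⁻¹∘shear : ∀ X → shear⁻¹ (shear X) ≡ X
  shear⁻¹∘shear (mat a b c d) = cong (λ c → mat a b c d) (cancel c _ _)
    where
    cancel : ∀ c x y → c - x + y + x - y ≡ c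
    cancel = solve-∀

  shear∘shear⁻¹ : ∀ X → shear (shear⁻¹ X) ≡ X
  shear∘shear⁻¹ (mat a b c d) = cong (λ c → mat a b c d) (cancel c _ _)
    where
    cancel : ∀ c x y → c + x - y - x + y ≡ c
    cancel = solve-∀

  reflect-involutive : ∀ X → reflect (reflect X) ≡ X
  reflect-involutive (mat a b c d) =
    cong₂ (λ a d → mat a b c d) (involutive a _ _) (involutive d _ _)
    where
    involutive : ∀ x u v → - (- x + u - v) + u - v ≡ x
    involutive = solve-∀

  ψ⁻¹ : Mat → Mat
  ψ⁻¹ X = shear⁻¹ (reflect X)

  ψ⁻¹∘ψ : ∀ X → ψ⁻¹ (ψ k X) ≡ X
  ψ⁻¹∘ψ X = begin
    ψ⁻¹ (ψ k X)                           ≡⟨ cong ψ⁻¹ (ψ≡reflect∘shear X) ⟩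
    shear⁻¹ (reflect (reflect (shear X))) ≡⟨ cong shear⁻¹ (reflect-involutive (shear X)) ⟩
    shear⁻¹ (shear X)                     ≡⟨ shear⁻¹∘shear X ⟩
    X                                     ∎

  ψ∘ψ⁻¹ : ∀ X → ψ k (ψ⁻¹ X) ≡ X
  ψ∘ψ⁻¹ X = begin
    ψ k (ψ⁻¹ X)                           ≡⟨ ψ≡reflect∘shear (ψ⁻¹ X) ⟩
    reflect (shear (shear⁻¹ (reflect X))) ≡⟨ cong reflect (shear∘shear⁻¹ (reflect X)) ⟩
    reflect (reflect X)                   ≡⟨ reflect-involutive X ⟩
    X                                     ∎

  ψ-bijective : Bijective _≡_ _≡_ (ψ k)
  ψ-bijective = inverseᵇ⇒bijective
    ( strictlyInverseˡ⇒inverseˡ {f⁻¹ = ψ⁻¹} (ψ k) ψ∘ψ⁻¹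
    , strictlyInverseʳ⇒inverseʳ {f⁻¹ = ψ⁻¹} (ψ k) ψ⁻¹∘ψ)

  tr+tr-ψ : ∀ X → tr X + tr (ψ k X) ≡ - K + ((+ 3 * K + + 3) * m12 X - K)
  tr+tr-ψ (mat a b c d) = expand a b d K
    where
    expand : ∀ a b d K →
      a + d + ((- a + b * K - K) + (- d + (+ 2 * K + + 3) * b - K))
        ≡ - K + ((+ 3 * K + + 3) * b - K)
    expand = solve-∀

  tr≡-k⇔tr-ψ≡gc : ∀ X → (tr X ≡ - K ⇔ tr (ψ k X) ≡ (+ 3 * K + + 3) * m12 X - K)
  tr≡-k⇔tr-ψ≡gc X = equal-sums⇒≡ˡ⇔≡ʳ (tr+tr-ψ X)

  det-ψ : ∀ X → det (ψ k X) ≡ det X - K * (m12 X - + 1) * (tr X + K)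
  det-ψ (mat a b c d) = expand a b c d K
    where
    expand : ∀ a b c d K →
      (- a + b * K - K) * (- d + (+ 2 * K + + 3) * b - K)
        - b * (c - (K + + 3) * a + K * (+ 2 * K + + 3) * (b - + 1))
        ≡ (a * d - b * c) - K * (b - + 1) * (a + d + K)
    expand = solve-∀

  tr≡-k⇒det-ψ≡det : ∀ X → tr X ≡ - K → det (ψ k X) ≡ det X
  tr≡-k⇒det-ψ≡det X tr≡-k = begin
    det (ψ k X)                               ≡⟨ det-ψ X ⟩
    det X - K * (m12 X - + 1) * (tr X + K)    ≡⟨ cong (λ z → det X - K * (m12 X - + 1) * z)
                                                   (i≡-j⇒i+j≡0 tr≡-k) ⟩
    det X - K * (m12 X - + 1) * +0            ≡⟨ cong (λ z → det X - z) (*-zeroʳ (K * (m12 X - + 1))) ⟩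
    det X + +0                                ≡⟨ +-identityʳ (det X) ⟩
    det X                                     ∎

  IsMM⇒IsGC-ψ : ∀ X → IsMM k X → IsGC k (ψ k X)
  IsMM⇒IsGC-ψ X (det≡1 , gm , tr≡-k) =
    trans (tr≡-k⇒det-ψ≡det X tr≡-k) det≡1 , gm , Equivalence.to (tr≡-k⇔tr-ψ≡gc X) tr≡-k

  IsGC-ψ⇒IsMM : ∀ X → IsGC k (ψ k X) → IsMM k X
  IsGC-ψ⇒IsMM X (det≡1 , gm , tr≡gc) =
    trans (sym (tr≡-k⇒det-ψ≡det X tr≡-k)) det≡1 , gm , tr≡-k
    where
    tr≡-k : tr X ≡ - K
    tr≡-k = Equivalence.from (tr≡-k⇔tr-ψ≡gc X) tr≡gc

proposition5p3 : (k : ℕ) →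
    Bijective _≡_ _≡_ (ψ k) ×
    ((X : Mat) → IsMM k X → IsGC k (ψ k X)) ×
    ((P : Mat) → IsGC k P → Σ Mat (λ X → IsMM k X × ψ k X ≡ P))
proposition5p3 k = ψ-bijective k , IsMM⇒IsGC-ψ k , preimage
  where
  preimage : (P : Mat) → IsGC k P → Σ Mat (λ X → IsMM k X × ψ k X ≡ P)
  preimage P gc = ψ⁻¹ k P , IsGC-ψ⇒IsMM k (ψ⁻¹ k P) gc′ , ψ∘ψ⁻¹ k P
    where
    gc′ : IsGC k (ψ k (ψ⁻¹ k P))
    gc′ = subst (IsGC k) (sym (ψ∘ψ⁻¹ k P)) gc
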